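{- Let $G=(V,E)$ be a finite simple graph and $C\subseteq V$. The following assertions are equivalent: (a) $C$ is full-separating, i.e. for every pair of distinct vertices $u,v\in V$ we have $(N(v)\cap C)\setminus\{u\}\neq (N(u)\cap C)\setminus\{v\}$. (b) $C\cap\big((N(u)\bigtriangleup N(v))\setminus\{u,v\}\big)\neq\emptyset$ for all distinct $u,v\in V$. (c) $C\cap (N[u]\bigtriangleup N[v])\neq\emptyset$ for every pair of adjacent vertices $u,v\in V$, and $C\cap (N(u)\bigtriangleup N(v))\neq\emptyset$ for every pair of distinct non-adjacent vertices $u,v\in V$. (d) $N[u]\cap C\neq N[v]\cap C$ and $N(u)\cap C\neq N(v)\cap C$ for each pair of distinct vertices $u,v\in V$. (e) $C$ is both a closed-separating and an open-separating set of $G$.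
   Context: For a vertex $v$, $N(v)=\{u\in V: uv\in E\}$ is its open neighborhood and $N[v]=N(v)\cup\{v\}$ its closed neighborhood. $A\bigtriangleup B=(A\setminus B)\cup(B\setminus A)$ is the symmetric difference. A set $C\subseteq V$ is closed-separating if the sets $N[v]\cap C$, $v\in V$, are pairwise distinct, and open-separating if the sets $N(v)\cap C$, $v\in V$, are pairwise distinct. -}

module Defs where

open import Data.Nat using (ℕ)
open import Data.Fin using (Fin)
open import Data.Bool using (Bool; true; false)
open import Data.Sum using (_⊎_)
open import Data.Product using (_×_)
open import Relation.Nullary using (¬_)
open import Relation.Binary.PropositionalEquality using (_≡_; _≢_)
open import Relation.Unary using (Pred; _∩_; _∪_; _∖_; _≐_; Satisfiable; ｛_｝)
open import Data.Fin.Subset using (Subset)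
import Data.Fin.Subset as S
open import Level using (0ℓ)

record Graph (n : ℕ) : Set where
  field
    adj     : Fin n → Fin n → Bool
    adj-sym : ∀ u v → adj u v ≡ adj v u
    adj-irr : ∀ v → adj v v ≡ false
open Graph public

module _ {n : ℕ} (G : Graph n) where

  Adjacent : Fin n → Fin n → Set
  Adjacent u v = adj G u v ≡ true

  N : Fin n → Pred (Fin n) 0ℓ
  N v w = Adjacent v w

  N[_] : Fin n → Pred (Fin n) 0ℓ
  N[ v ] = N v ∪ ｛ v ｝

⟦_⟧ : {n : ℕ} → Subset n → Pred (Fin n) 0ℓ
⟦ C ⟧ w = w S.∈ C

_△_ : {n : ℕ} → Pred (Fin n) 0ℓ → Pred (Fin n) 0ℓ → Pred (Fin n) 0ℓ
A △ B = (A ∖ B) ∪ (B ∖ A)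

module _ {n : ℕ} (G : Graph n) (C : Subset n) where

  FullSeparating : Set
  FullSeparating = ∀ u v → u ≢ v →
    ¬ (((N G v ∩ ⟦ C ⟧) ∖ ｛ u ｝) ≐ ((N G u ∩ ⟦ C ⟧) ∖ ｛ v ｝))

  CondB : Set
  CondB = ∀ u v → u ≢ v →
    Satisfiable (⟦ C ⟧ ∩ ((N G u △ N G v) ∖ (｛ u ｝ ∪ ｛ v ｝)))

  CondC : Set
  CondC = (∀ u v → Adjacent G u v → Satisfiable (⟦ C ⟧ ∩ (N[_] G u △ N[_] G v)))
        × (∀ u v → u ≢ v → ¬ Adjacent G u v → Satisfiable (⟦ C ⟧ ∩ (N G u △ N G v)))

  CondD : Set
  CondD = ∀ u v → u ≢ v →
    ¬ ((N[_] G u ∩ ⟦ C ⟧) ≐ (N[_] G v ∩ ⟦ C ⟧)) × ¬ ((N G u ∩ ⟦ C ⟧) ≐ (N G v ∩ ⟦ C ⟧))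

  ClosedSeparating : Set
  ClosedSeparating = ∀ u v → u ≢ v → ¬ ((N[_] G u ∩ ⟦ C ⟧) ≐ (N[_] G v ∩ ⟦ C ⟧))

  OpenSeparating : Set
  OpenSeparating = ∀ u v → u ≢ v → ¬ ((N G u ∩ ⟦ C ⟧) ≐ (N G v ∩ ⟦ C ⟧))

  CondE : Set
  CondE = ClosedSeparating × OpenSeparating

-- Call w a separator of u and v if w ∈ C ∖ {u, v} and w is adjacent to exactly
-- one of u, v; condition (b) says every pair of distinct vertices has one.  A
-- separator lies in both N(u) △ N(v) and N[u] △ N[v], which gives (b) ⇒ (a),
-- (c), (d).  Conversely, if u and v have no separator then N(u) and N(v) agree
-- on C ∖ {u, v}, so N[u] ∩ C = N[v] ∩ C when u ~ v and N(u) ∩ C = N(v) ∩ C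
-- otherwise, contradicting (a), (c) and (d).  Having a separator is decidable,
-- so refuting its absence produces one.
module Submission where

open import Data.Nat using (ℕ)
open import Data.Fin using (Fin)
open import Data.Fin.Properties using (any?) renaming (_≟_ to _≟ᶠ_)
open import Data.Fin.Subset using (Subset)
open import Data.Fin.Subset.Properties using (_∈?_)
open import Data.Bool using (true)
open import Data.Bool.Properties using () renaming (_≟_ to _≟ᵇ_)
open import Data.Product using (_×_; _,_; proj₁; proj₂)
open import Data.Sum using (inj₁; inj₂; [_,_]; swap)
open import Function using (_∘_)
open import Function.Bundles using (_⇔_; mk⇔)
open import Level using (0ℓ)
open import Relation.Nullary using (¬_; yes; no)
open import Relation.Nullary.Decidable using (decidable-stable)
open import Relation.Unary
  using (Pred; Decidable; Satisfiable; _∈_; _∩_; _∪_; _∖_; _⊆_; _≐_; ｛_｝)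
open import Relation.Unary.Properties using (_∩?_; _∪?_; ∁?)
open import Relation.Binary.PropositionalEquality using (_≢_; refl; sym; trans)
open import Defs

≐-restricted⇒¬△ : ∀ {n} {P Q R : Pred (Fin n) 0ℓ} →
  (P ∩ R) ≐ (Q ∩ R) → ¬ Satisfiable (R ∩ (P △ Q))
≐-restricted⇒¬△ (P⊆Q , _) (_ , r , inj₁ (p , ¬q)) = ¬q (proj₁ (P⊆Q (p , r)))
≐-restricted⇒¬△ (_ , Q⊆P) (_ , r , inj₂ (q , ¬p)) = ¬p (proj₁ (Q⊆P (q , r)))

module _ {n : ℕ} (G : Graph n) where

  adjacent-irrefl : ∀ {u w} → Adjacent G u w → u ≢ w
  adjacent-irrefl {u} uw refl with trans (sym uw) (adj-irr G u)
  ... | ()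

  adjacent-sym : ∀ {u v} → Adjacent G u v → Adjacent G v u
  adjacent-sym {u} {v} = trans (adj-sym G v u)

  adjacent? : ∀ u → Decidable (N G u)
  adjacent? u w = adj G u w ≟ᵇ true

module Separation {n : ℕ} (G : Graph n) (C : Subset n) where

  Separator : Fin n → Fin n → Pred (Fin n) 0ℓ
  Separator u v = ⟦ C ⟧ ∩ ((N G u △ N G v) ∖ (｛ u ｝ ∪ ｛ v ｝))

  Separated : Fin n → Fin n → Set
  Separated u v = Satisfiable (Separator u v)

  separator? : ∀ u v → Decidable (Separator u v)
  separator? u v = (_∈? C) ∩?
    (((adjacent? G u ∩? ∁? (adjacent? G v)) ∪? (adjacent? G v ∩? ∁? (adjacent? G u)))
      ∩? ∁? ((u ≟ᶠ_) ∪? (v ≟ᶠ_)))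

  separated-stable : ∀ u v → ¬ ¬ Separated u v → Separated u v
  separated-stable u v = decidable-stable (any? (separator? u v))

  separated-sym : ∀ {u v} → Separated u v → Separated v u
  separated-sym (w , c , d , w∉uv) = w , c , swap d , w∉uv ∘ swap

  separator⇒N△ : ∀ {u v} → Separator u v ⊆ ⟦ C ⟧ ∩ (N G u △ N G v)
  separator⇒N△ (c , d , _) = c , d

  separator⇒N[]△ : ∀ {u v} → Separator u v ⊆ ⟦ C ⟧ ∩ (N[_] G u △ N[_] G v)
  separator⇒N[]△ (c , inj₁ (uw , ¬vw) , w∉uv) = c , inj₁ (inj₁ uw , [ ¬vw , w∉uv ∘ inj₂ ])
  separator⇒N[]△ (c , inj₂ (vw , ¬uw) , w∉uv) = c , inj₂ (inj₁ vw , [ ¬uw , w∉uv ∘ inj₁ ])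

  module _ {u v : Fin n} (unseparated : ¬ Separated u v) where

    unseparated⇒adjacent : ∀ {w} → w ∈ (N G u ∩ ⟦ C ⟧) ∖ ｛ v ｝ → Adjacent G v w
    unseparated⇒adjacent {w} ((uw , c) , v≢w) =
      decidable-stable (adjacent? G v w) λ ¬vw →
        unseparated (w , c , inj₁ (uw , ¬vw) , [ adjacent-irrefl G uw , v≢w ])

    unseparated⇒full-⊆ : (N G u ∩ ⟦ C ⟧) ∖ ｛ v ｝ ⊆ (N G v ∩ ⟦ C ⟧) ∖ ｛ u ｝
    unseparated⇒full-⊆ w∈@((uw , c) , _) =
      (unseparated⇒adjacent w∈ , c) , adjacent-irrefl G uw

    unseparated⇒closed-⊆ : Adjacent G u v → N[_] G u ∩ ⟦ C ⟧ ⊆ N[_] G v ∩ ⟦ C ⟧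
    unseparated⇒closed-⊆ uv (inj₂ refl , c) = inj₁ (adjacent-sym G uv) , c
    unseparated⇒closed-⊆ uv {w} (inj₁ uw , c) with v ≟ᶠ w
    ... | yes v≡w = inj₂ v≡w , c
    ... | no  v≢w = inj₁ (unseparated⇒adjacent ((uw , c) , v≢w)) , c

    unseparated⇒open-⊆ : ¬ Adjacent G u v → N G u ∩ ⟦ C ⟧ ⊆ N G v ∩ ⟦ C ⟧
    unseparated⇒open-⊆ ¬uv {w} (uw , c) = unseparated⇒adjacent ((uw , c) , v≢w) , c
      where
        v≢w : v ≢ w
        v≢w refl = ¬uv uw

  module _ {u v : Fin n} (unseparated : ¬ Separated u v) where

    private
      unseparated′ : ¬ Separated v u
      unseparated′ = unseparated ∘ separated-sym

    unseparated⇒full-≐ : (N G v ∩ ⟦ C ⟧) ∖ ｛ u ｝ ≐ (N G u ∩ ⟦ C ⟧) ∖ ｛ v ｝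
    unseparated⇒full-≐ = unseparated⇒full-⊆ unseparated′ , unseparated⇒full-⊆ unseparated

    unseparated⇒closed-≐ : Adjacent G u v → N[_] G u ∩ ⟦ C ⟧ ≐ N[_] G v ∩ ⟦ C ⟧
    unseparated⇒closed-≐ uv =
      unseparated⇒closed-⊆ unseparated uv , unseparated⇒closed-⊆ unseparated′ (adjacent-sym G uv)

    unseparated⇒open-≐ : ¬ Adjacent G u v → N G u ∩ ⟦ C ⟧ ≐ N G v ∩ ⟦ C ⟧
    unseparated⇒open-≐ ¬uv =
      unseparated⇒open-⊆ unseparated ¬uv , unseparated⇒open-⊆ unseparated′ (¬uv ∘ adjacent-sym G)

  separated⇒¬full-≐ : ∀ {u v} → Separated u v →
    ¬ ((N G v ∩ ⟦ C ⟧) ∖ ｛ u ｝ ≐ (N G u ∩ ⟦ C ⟧) ∖ ｛ v ｝)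
  separated⇒¬full-≐ (_ , c , inj₁ (uw , ¬vw) , w∉uv) (_ , u⊆v) =
    ¬vw (proj₁ (proj₁ (u⊆v ((uw , c) , w∉uv ∘ inj₂))))
  separated⇒¬full-≐ (_ , c , inj₂ (vw , ¬uw) , w∉uv) (v⊆u , _) =
    ¬uw (proj₁ (proj₁ (v⊆u ((vw , c) , w∉uv ∘ inj₁))))

  full⇒b : FullSeparating G C → CondB G C
  full⇒b full u v u≢v = separated-stable u v (full u v u≢v ∘ unseparated⇒full-≐)

  b⇒full : CondB G C → FullSeparating G C
  b⇒full b u v u≢v = separated⇒¬full-≐ (b u v u≢v)

  b⇒c : CondB G C → CondC G C
  b⇒c b = (λ u v uv → let w , s = b u v (adjacent-irrefl G uv) in w , separator⇒N[]△ s)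
        , (λ u v u≢v _ → let w , s = b u v u≢v in w , separator⇒N△ s)

  c⇒b : CondC G C → CondB G C
  c⇒b (closed , open′) u v u≢v = separated-stable u v refute
    where
      refute : ¬ ¬ Separated u v
      refute unseparated with adjacent? G u v
      ... | yes uv  = ≐-restricted⇒¬△ (unseparated⇒closed-≐ unseparated uv) (closed u v uv)
      ... | no  ¬uv = ≐-restricted⇒¬△ (unseparated⇒open-≐ unseparated ¬uv) (open′ u v u≢v ¬uv)

  b⇒d : CondB G C → CondD G C
  b⇒d b u v u≢v with b u v u≢v
  ... | w , s =
    (λ closed-≐ → ≐-restricted⇒¬△ closed-≐ (w , separator⇒N[]△ s)) ,
    (λ open-≐ → ≐-restricted⇒¬△ open-≐ (w , separator⇒N△ s))

  d⇒b : CondD G C → CondB G C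
  d⇒b d u v u≢v = separated-stable u v refute
    where
      refute : ¬ ¬ Separated u v
      refute unseparated with adjacent? G u v
      ... | yes uv  = proj₁ (d u v u≢v) (unseparated⇒closed-≐ unseparated uv)
      ... | no  ¬uv = proj₂ (d u v u≢v) (unseparated⇒open-≐ unseparated ¬uv)

  d⇒e : CondD G C → CondE G C
  d⇒e d = (λ u v → proj₁ ∘ d u v) , (λ u v → proj₂ ∘ d u v)

  e⇒d : CondE G C → CondD G C
  e⇒d (closed , open′) u v u≢v = closed u v u≢v , open′ u v u≢v

theorem1 : {n : ℕ} (G : Graph n) (C : Subset n) →
    (FullSeparating G C ⇔ CondB G C) × (CondB G C ⇔ CondC G C)
      × (CondC G C ⇔ CondD G C) × (CondD G C ⇔ CondE G C)
theorem1 G C =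
    mk⇔ full⇒b b⇒full
  , mk⇔ b⇒c c⇒b
  , mk⇔ (b⇒d ∘ c⇒b) (b⇒c ∘ d⇒b)
  , mk⇔ d⇒e e⇒d
  where open Separation G C
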